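{- Let $P$ be the set of all integer partitions and $D$ the set of partitions into distinct parts (each including the empty partition of $0$). Define $P_1:=\{\pi\in D:\#(\pi)\not\equiv 0 \pmod 3\}$, $P_2:=\{\pi\in P: \text{no part of }\pi\text{ is divisible by }3\}$, and $P_3:=\{\pi\in P:\#(\pi)\not\equiv 0\pmod 3\}$. For a partition $\pi$ let $\sigma(\pi)=1$ if $\#(\pi)\equiv 2\pmod 3$ and $\sigma(\pi)=0$ otherwise, and let $\mu(\pi):=\#(\pi)+\sigma(\pi)+1$. Then, as formal power series in $q$, \[ \sum_{\pi\in P_1}(-1)^{\mu(\pi)}q^{|\pi|}=\sum_{(\pi_1,\pi_2)\in P_2\times P_3}(-1)^{\sigma(\pi_2)}q^{|\pi_1|+|\pi_2|}. \]
   Context: A partition of a non-negative integer $n$ is a non-increasing finite sequence of positive integers summing to $n$; the empty sequence is the unique partition of $0$. For a partition $\pi$, $|\pi|$ denotes the sum of its parts and $\#(\pi)$ its number of parts. -}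

module Defs where

open import Data.Bool using (Bool; true; false; if_then_else_; _∧_)
open import Data.Nat as ℕ using (ℕ; zero; suc; _≤_; _∸_; _%_)
open import Data.Nat.Properties using (_≟_)
open import Data.Nat.Divisibility using (_∣_; _∣?_)
open import Data.Integer as ℤ using (ℤ; +_; -[1+_])
open import Data.List using (List; []; _∷_; length; map; upTo)
open import Data.Nat.ListAction using (sum)
open import Data.List.Relation.Unary.All using (All; all?)
open import Data.List.Relation.Unary.Linked using (Linked)
open import Data.List.Relation.Unary.Unique.Propositional using (Unique)
open import Data.List.Relation.Unary.Unique.DecPropositional _≟_ using (unique?)
open import Data.Product using (_×_)
open import Relation.Nullary using (¬_; ¬?; does)
open import Relation.Binary.PropositionalEquality using (_≡_)

IsPartition : List ℕ → Set
IsPartition π = Linked ℕ._≥_ π × All (λ x → 1 ≤ x) π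

IsPartitionOf : ℕ → List ℕ → Set
IsPartitionOf n π = IsPartition π × sum π ≡ n

#_ : List ℕ → ℕ
# π = length π

distinct : List ℕ → Bool
distinct π = does (unique? π)

countNot0mod3 : List ℕ → Bool
countNot0mod3 π = does (¬? ((# π % 3) ≟ 0))

noPartDiv3 : List ℕ → Bool
noPartDiv3 π = does (all? (λ x → ¬? (3 ∣? x)) π)

σ : List ℕ → ℕ
σ π = if does ((# π % 3) ≟ 2) then 1 else 0

μ : List ℕ → ℕ
μ π = # π ℕ.+ σ π ℕ.+ 1

sgn : ℕ → ℤ
sgn k = -[1+ 0 ] ℤ.^ k

sumℤ : List ℤ → ℤ
sumℤ [] = + 0
sumℤ (x ∷ xs) = x ℤ.+ sumℤ xs

wP₁ : List ℕ → ℤ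
wP₁ π = if distinct π ∧ countNot0mod3 π then sgn (μ π) else + 0

wP₂ : List ℕ → ℤ
wP₂ π = if noPartDiv3 π then + 1 else + 0

wP₃ : List ℕ → ℤ
wP₃ π = if countNot0mod3 π then sgn (σ π) else + 0

-- Given an enumeration L n of the partitions of n (for each n),
-- coefficient of q^n on the LHS:  Σ_{π ∈ P₁, |π| = n} (-1)^μ(π)
lhsCoeff : (ℕ → List (List ℕ)) → ℕ → ℤ
lhsCoeff L n = sumℤ (map wP₁ (L n))

rhsCoeff : (ℕ → List (List ℕ)) → ℕ → ℤ
rhsCoeff L n = sumℤ (map (λ k → sumℤ (map wP₂ (L k)) ℤ.* sumℤ (map wP₃ (L (n ∸ k)))) (upTo (suc n)))

module Submission where

-- Let ω be a primitive cube root of unity. Weighting distinct partitions by (-ω)^#π gives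
-- ∏ (1 - ωq^j), weighting all partitions by ω^(2#π) gives ∏ (1 - ω²q^j)⁻¹, and counting the
-- partitions without parts divisible by 3 gives ∏_{3 ∤ j} (1 - q^j)⁻¹. Since
-- (1 - q^j)(1 - ωq^j)(1 - ω²q^j) = 1 - q^(3j), the first product is the product of the other two.
-- In ℤ[ω] the coordinate ν(a + bω) = -b of (-ω)^k is (-1)^(k + σ + 1), and that of ω^(2k) is
-- (-1)^σ, when 3 ∤ k, and both vanish otherwise; the third series is real. So ν of the
-- coefficient of q^n on both sides is the identity. Truncating all products at j ≤ 3n
-- leaves the coefficients up to q^n unchanged.

open import Defs

open import Level using (0ℓ)
open import Function using (_∘_; id)
open import Function.Bundles using (_⇔_; mk⇔; Equivalence)
open import Data.Bool using (true; false; if_then_else_; not; _∧_)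
open import Data.Maybe using (just; nothing)
open import Data.Product using (_×_; _,_; proj₁)
open import Data.Sum using ([_,_])
open import Relation.Nullary using (¬_; ¬?; does)
open import Relation.Nullary.Decidable using (dec-true; dec-false)
open import Relation.Binary.PropositionalEquality as ≡ using (_≡_)

open import Data.Nat as ℕ using (ℕ; zero; suc; _≤_; _<_; _∸_; z≤n; s≤s)
import Data.Nat.Properties as ℕ
open import Data.Nat.Divisibility using (_∣_; _∣?_; ∣⇒≤; ∣m+n∣m⇒∣n; m∣m*n; ∣m∣n⇒∣m+n; ∣-refl)
open import Data.Nat.ListAction using (sum)
import Data.Nat.Tactic.RingSolver as ℕ-Solver
open import Data.Integer as ℤ using (ℤ; 0ℤ; 1ℤ; -1ℤ)
import Data.Integer.Properties as ℤ
import Data.Integer.Tactic.RingSolver as ℤ-Solver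

open import Data.List using (List; []; _∷_; _++_; _∷ʳ_; map; foldr; concatMap; upTo; applyUpTo; downFrom; length)
open import Data.List.Properties using (foldr-++; ++-assoc; map-upTo; upTo-∷ʳ; map-cong; map-cong-local)
open import Data.List.Relation.Unary.All as All using (All; []; _∷_; all?)
import Data.List.Relation.Unary.All.Properties as All
open import Data.List.Relation.Unary.All.Properties using (applyUpTo⁺₁)
open import Data.List.Relation.Unary.AllPairs using ([]; _∷_)
open import Data.List.Relation.Unary.Any using (here)
open import Data.List.Relation.Unary.Linked as Linked using (Linked)
open import Data.List.Relation.Unary.Linked.Properties using (Linked⇒All)
open import Data.List.Relation.Unary.Unique.Propositional using (Unique)
import Data.List.Relation.Unary.Unique.Propositional.Properties as Unique
open import Data.List.Membership.Propositional using (_∈_)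
open import Data.List.Membership.Propositional.Properties using (∈-++⁺ˡ; ∈-++⁺ʳ; ∈-map⁺; ∈-map⁻)
open import Data.List.Membership.Propositional.Properties.WithK using (unique∧set⇒bag)
open import Data.List.Relation.Binary.BagAndSetEquality using (∼bag⇒↭)
open import Data.List.Relation.Binary.Permutation.Propositional as ↭ using (_↭_)

open import Algebra.Bundles using (CommutativeRing; Semiring)
open import Algebra.Structures using (IsCommutativeRing)
import Tactic.RingSolver as Solver
import Tactic.RingSolver.NonReflective as NonReflective
import Tactic.RingSolver.Core.AlmostCommutativeRing as ACR

-- Partitions with bounded parts

BoundedPartitionOf : ℕ → ℕ → List ℕ → Set
BoundedPartitionOf m n π = IsPartitionOf n π × All (_≤ m) π

mutual
  boundedPartitions : ℕ → ℕ → List (List ℕ)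
  boundedPartitions zero    zero    = [] ∷ []
  boundedPartitions zero    (suc n) = []
  boundedPartitions (suc m) n       =
    boundedPartitions m n ++ map (suc m ∷_) (shiftedPartitions (suc m) m n)

  -- shiftedPartitions j k n is boundedPartitions j (n ∸ suc k) if k < n and [] otherwise;
  -- recursing on n here, rather than subtracting, is what makes the definition structural.
  shiftedPartitions : ℕ → ℕ → ℕ → List (List ℕ)
  shiftedPartitions j k       zero    = []
  shiftedPartitions j zero    (suc n) = boundedPartitions j n
  shiftedPartitions j (suc k) (suc n) = shiftedPartitions j k n

linked-cons : ∀ {x xs} → All (_≤ x) xs → Linked ℕ._≥_ xs → Linked ℕ._≥_ (x ∷ xs)
linked-cons {xs = []}    _          _      = Linked.[-]
linked-cons {xs = _ ∷ _} (y≤x ∷ _) linked = y≤x Linked.∷ linked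

linked⇒parts≤head : ∀ {x xs} → Linked ℕ._≥_ (x ∷ xs) → All (_≤ x) (x ∷ xs)
linked⇒parts≤head = Linked⇒All (λ z≤y y≤x → ℕ.≤-trans y≤x z≤y) ℕ.≤-refl

cons-boundedPartition : ∀ {m n π} → suc m ≤ n → BoundedPartitionOf (suc m) (n ∸ suc m) π →
                        BoundedPartitionOf (suc m) n (suc m ∷ π)
cons-boundedPartition {m} m<n (((linked , positive) , sum≡) , bounded) =
  ((linked-cons bounded linked , s≤s z≤n ∷ positive) ,
   ≡.trans (≡.cong (suc m ℕ.+_) sum≡) (ℕ.m+[n∸m]≡n m<n)) ,
  ℕ.≤-refl ∷ bounded

mutual
  boundedPartitions-sound : ∀ m n → All (BoundedPartitionOf m n) (boundedPartitions m n)
  boundedPartitions-sound zero    zero    = (((Linked.[] , []) , ≡.refl) , []) ∷ []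
  boundedPartitions-sound zero    (suc n) = []
  boundedPartitions-sound (suc m) n       = All.++⁺
    (All.map (λ (partition , bounded) → partition , All.map ℕ.m≤n⇒m≤1+n bounded)
             (boundedPartitions-sound m n))
    (All.map⁺ (All.map (λ (m<n , bp) → cons-boundedPartition m<n bp)
                       (shiftedPartitions-sound (suc m) m n)))

  shiftedPartitions-sound : ∀ j k n →
    All (λ π → suc k ≤ n × BoundedPartitionOf j (n ∸ suc k) π) (shiftedPartitions j k n)
  shiftedPartitions-sound j k       zero    = []
  shiftedPartitions-sound j zero    (suc n) =
    All.map (s≤s z≤n ,_) (boundedPartitions-sound j n)
  shiftedPartitions-sound j (suc k) (suc n) =
    All.map (λ (k<n , bp) → s≤s k<n , bp) (shiftedPartitions-sound j k n)

∈-shiftedPartitions : ∀ {j π} k r → π ∈ boundedPartitions j r →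
                      π ∈ shiftedPartitions j k (suc k ℕ.+ r)
∈-shiftedPartitions zero    r π∈ = π∈
∈-shiftedPartitions (suc k) r π∈ = ∈-shiftedPartitions k r π∈

boundedPartitions-complete : ∀ m π → IsPartition π → All (_≤ m) π →
                             π ∈ boundedPartitions m (sum π)
boundedPartitions-complete zero    []      _ _ = here ≡.refl
boundedPartitions-complete zero    (x ∷ π) (_ , s≤s _ ∷ _) (() ∷ _)
boundedPartitions-complete (suc m) []      _ _ = ∈-++⁺ˡ (boundedPartitions-complete m [] (Linked.[] , []) [])
boundedPartitions-complete (suc m) (x ∷ π) (linked , positive) (x≤1+m ∷ bounded) =
  [ (λ x<1+m → ∈-++⁺ˡ (boundedPartitions-complete m (x ∷ π) (linked , positive)
                 (All.map (λ y≤x → ℕ.≤-trans y≤x (ℕ.≤-pred x<1+m)) (linked⇒parts≤head linked))))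
  , (λ x≡1+m → ≡.subst (λ y → y ∷ π ∈ boundedPartitions (suc m) (y ℕ.+ sum π)) (≡.sym x≡1+m)
                 (∈-++⁺ʳ _ (∈-map⁺ (suc m ∷_) (∈-shiftedPartitions m (sum π)
                   (boundedPartitions-complete (suc m) π (Linked.tail linked , All.tail positive) bounded)))))
  ] (ℕ.m≤n⇒m<n∨m≡n x≤1+m)

mutual
  boundedPartitions-unique : ∀ m n → Unique (boundedPartitions m n)
  boundedPartitions-unique zero    zero    = [] ∷ []
  boundedPartitions-unique zero    (suc n) = []
  boundedPartitions-unique (suc m) n       = Unique.++⁺
    (boundedPartitions-unique m n)
    (Unique.map⁺ (λ { ≡.refl → ≡.refl }) (shiftedPartitions-unique (suc m) m n))
    largestPart-differs
    where
    largestPart-differs : ∀ {π} →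
      ¬ (π ∈ boundedPartitions m n × π ∈ map (suc m ∷_) (shiftedPartitions (suc m) m n))
    largestPart-differs (π∈ , π∈′) with ∈-map⁻ (suc m ∷_) π∈′
    ... | _ , _ , ≡.refl with All.lookup (boundedPartitions-sound m n) π∈
    ...   | _ , 1+m≤m ∷ _ = ℕ.1+n≰n 1+m≤m

  shiftedPartitions-unique : ∀ j k n → Unique (shiftedPartitions j k n)
  shiftedPartitions-unique j k       zero    = []
  shiftedPartitions-unique j zero    (suc n) = boundedPartitions-unique j n
  shiftedPartitions-unique j (suc k) (suc n) = shiftedPartitions-unique j k n

parts≤sum : ∀ π → All (_≤ sum π) π
parts≤sum []      = []
parts≤sum (x ∷ π) =
  ℕ.m≤m+n x (sum π) ∷ All.map (λ y≤ → ℕ.≤-trans y≤ (ℕ.m≤n+m (sum π) x)) (parts≤sum π)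

∈-boundedPartitions⇔ : ∀ {m n} → n ≤ m → ∀ π → π ∈ boundedPartitions m n ⇔ IsPartitionOf n π
∈-boundedPartitions⇔ {m} {n} n≤m π = mk⇔
  (λ π∈ → proj₁ (All.lookup (boundedPartitions-sound m n) π∈))
  (λ { (partition , ≡.refl) → boundedPartitions-complete m π partition
         (All.map (λ x≤ → ℕ.≤-trans x≤ n≤m) (parts≤sum π)) })

↭-boundedPartitions : ∀ {m n xs} → Unique xs → (∀ π → π ∈ xs ⇔ IsPartitionOf n π) → n ≤ m →
                      xs ↭ boundedPartitions m n
↭-boundedPartitions {m} {n} unique enumerates n≤m =
  ∼bag⇒↭ (unique∧set⇒bag unique (boundedPartitions-unique m n) (λ {π} → mk⇔
    (λ π∈ → Equivalence.from (∈-boundedPartitions⇔ n≤m π) (Equivalence.to (enumerates π) π∈))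
    (λ π∈ → Equivalence.from (enumerates π) (Equivalence.to (∈-boundedPartitions⇔ n≤m π) π∈))))

∤-remainder : ∀ {d r} q → 0 < r → r < d → ¬ d ∣ r ℕ.+ d ℕ.* q
∤-remainder {d} {r@(suc _)} q _ r<d d∣r+dq =
  ℕ.<⇒≱ r<d (∣⇒≤ (∣m+n∣m⇒∣n (≡.subst (d ∣_) (ℕ.+-comm r (d ℕ.* q)) d∣r+dq) (m∣m*n q)))

-- Formal power series over a commutative ring

module PowerSeries (R : CommutativeRing 0ℓ 0ℓ) where

  open CommutativeRing R
  open import Algebra.Properties.Ring ring using (-0#≈0#; -‿distribˡ-*; +-cancelʳ; x[y-z]≈xy-xz; [y-z]x≈yx-zx)
  open import Algebra.Properties.CommutativeSemigroup *-commutativeSemigroup using (x∙yz≈y∙xz)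
  open import Algebra.Properties.CommutativeSemigroup +-commutativeSemigroup using () renaming (x∙yz≈y∙xz to x+yz≈y+xz)
  open import Relation.Binary.Reasoning.Setoid setoid
  open NonReflective (ACR.fromCommutativeRing R (λ _ → nothing)) using (solve; _⊜_; _⊕_; _⊗_; ⊝_)

  x-c*0≈x : ∀ c x → x - c * 0# ≈ x
  x-c*0≈x c x = trans (+-congˡ (trans (-‿cong (zeroʳ c)) -0#≈0#)) (+-identityʳ x)

  sumBy : {A : Set} → (A → Carrier) → List A → Carrier
  sumBy w []       = 0#
  sumBy w (x ∷ xs) = w x + sumBy w xs

  module _ {A : Set} where

    sumBy-cong-local : ∀ {v w : A → Carrier} {xs} → All (λ x → v x ≈ w x) xs → sumBy v xs ≈ sumBy w xs
    sumBy-cong-local []         = refl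
    sumBy-cong-local (eq ∷ eqs) = +-cong eq (sumBy-cong-local eqs)

    sumBy-cong : ∀ {v w : A → Carrier} → (∀ x → v x ≈ w x) → ∀ xs → sumBy v xs ≈ sumBy w xs
    sumBy-cong v≈w []       = refl
    sumBy-cong v≈w (x ∷ xs) = +-cong (v≈w x) (sumBy-cong v≈w xs)

    sumBy-++ : ∀ (w : A → Carrier) xs ys → sumBy w (xs ++ ys) ≈ sumBy w xs + sumBy w ys
    sumBy-++ w []       ys = sym (+-identityˡ _)
    sumBy-++ w (x ∷ xs) ys = trans (+-congˡ (sumBy-++ w xs ys)) (sym (+-assoc _ _ _))

    sumBy-∷ʳ : ∀ (w : A → Carrier) xs x → sumBy w (xs ∷ʳ x) ≈ sumBy w xs + w x
    sumBy-∷ʳ w xs x = trans (sumBy-++ w xs (x ∷ [])) (+-congˡ (+-identityʳ (w x)))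

    sumBy-map : ∀ {B : Set} (w : B → Carrier) (g : A → B) xs → sumBy w (map g xs) ≡ sumBy (w ∘ g) xs
    sumBy-map w g []       = ≡.refl
    sumBy-map w g (x ∷ xs) = ≡.cong (w (g x) +_) (sumBy-map w g xs)

    sumBy-* : ∀ c (w : A → Carrier) xs → sumBy (λ x → c * w x) xs ≈ c * sumBy w xs
    sumBy-* c w []       = sym (zeroʳ c)
    sumBy-* c w (x ∷ xs) = trans (+-congˡ (sumBy-* c w xs)) (sym (distribˡ c (w x) (sumBy w xs)))

    sumBy-linear : ∀ (v : A → Carrier) c w xs →
                   sumBy (λ x → v x - c * w x) xs ≈ sumBy v xs - c * sumBy w xs
    sumBy-linear v c w []       = sym (x-c*0≈x c 0#)
    sumBy-linear v c w (x ∷ xs) = trans (+-congˡ (sumBy-linear v c w xs))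
      (solve 5 (λ a b c s t → ((a ⊕ ⊝ (c ⊗ b)) ⊕ (s ⊕ ⊝ (c ⊗ t))) ⊜ ((a ⊕ s) ⊕ ⊝ (c ⊗ (b ⊕ t))))
             refl (v x) (w x) c (sumBy v xs) (sumBy w xs))

    sumBy-zero : ∀ {w : A → Carrier} → (∀ x → w x ≈ 0#) → ∀ xs → sumBy w xs ≈ 0#
    sumBy-zero w≈0 []       = refl
    sumBy-zero w≈0 (x ∷ xs) = trans (+-cong (w≈0 x) (sumBy-zero w≈0 xs)) (+-identityˡ 0#)

    sumBy-↭ : ∀ (w : A → Carrier) {xs ys} → xs ↭ ys → sumBy w xs ≈ sumBy w ys
    sumBy-↭ w ↭.refl          = refl
    sumBy-↭ w (↭.prep x p)    = +-congˡ (sumBy-↭ w p)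
    sumBy-↭ w (↭.swap x y p)  = trans (+-congˡ (+-congˡ (sumBy-↭ w p))) (x+yz≈y+xz (w x) (w y) _)
    sumBy-↭ w (↭.trans p q)   = trans (sumBy-↭ w p) (sumBy-↭ w q)

  Series : Set
  Series = ℕ → Carrier

  infix 4 _≋_ _≋[_]_

  _≋_ : Series → Series → Set
  f ≋ g = ∀ n → f n ≈ g n

  _≋[_]_ : Series → ℕ → Series → Set
  f ≋[ N ] g = ∀ {k} → k ≤ N → f k ≈ g k

  one : Series
  one zero    = 1#
  one (suc n) = 0#

  shift₁ : Series → Series
  shift₁ f zero    = 0#
  shift₁ f (suc n) = f n

  shift : ℕ → Series → Series
  shift zero    f = f
  shift (suc j) f = shift₁ (shift j f)

  shift-cong : ∀ j {f g} → f ≋ g → shift j f ≋ shift j g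
  shift-cong zero    f≋g n       = f≋g n
  shift-cong (suc j) f≋g zero    = refl
  shift-cong (suc j) f≋g (suc n) = shift-cong j f≋g n

  shift-+ : ∀ i j f n → shift i (shift j f) n ≡ shift (i ℕ.+ j) f n
  shift-+ zero    j f n       = ≡.refl
  shift-+ (suc i) j f zero    = ≡.refl
  shift-+ (suc i) j f (suc n) = shift-+ i j f n

  shift-comm : ∀ i j f n → shift i (shift j f) n ≡ shift j (shift i f) n
  shift-comm i j f n = ≡.trans (shift-+ i j f n)
    (≡.trans (≡.cong (λ k → shift k f n) (ℕ.+-comm i j)) (≡.sym (shift-+ j i f n)))

  shift-below : ∀ {j k} f → k < j → shift j f k ≡ 0#
  shift-below {suc j} {zero}  f _         = ≡.refl
  shift-below {suc j} {suc k} f (s≤s k<j) = shift-below f k<j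

  shift-map : ∀ j (φ : Carrier → Carrier) → φ 0# ≈ 0# → ∀ f → shift j (φ ∘ f) ≋ φ ∘ shift j f
  shift-map zero    φ φ0≈0 f n       = refl
  shift-map (suc j) φ φ0≈0 f zero    = sym φ0≈0
  shift-map (suc j) φ φ0≈0 f (suc n) = shift-map j φ φ0≈0 f n

  shift-zipWith : ∀ j (φ : Carrier → Carrier → Carrier) → φ 0# 0# ≈ 0# → ∀ f g →
                  shift j (λ n → φ (f n) (g n)) ≋ λ n → φ (shift j f n) (shift j g n)
  shift-zipWith zero    φ φ0≈0 f g n       = refl
  shift-zipWith (suc j) φ φ0≈0 f g zero    = sym φ0≈0
  shift-zipWith (suc j) φ φ0≈0 f g (suc n) = shift-zipWith j φ φ0≈0 f g n

  -- (c , e) stands for the binomial 1 - c q^(1+e); exponents are positive by construction.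
  Binomial : Set
  Binomial = Carrier × ℕ

  factor : Binomial → Series → Series
  factor (c , e) f n = f n - c * shift (suc e) f n

  factors : List Binomial → Series → Series
  factors xs f = foldr factor f xs

  shift-factor : ∀ j c e f → shift j (factor (c , e) f) ≋ λ n → shift j f n - c * shift j (shift (suc e) f) n
  shift-factor j c e f = shift-zipWith j (λ u v → u - c * v) (x-c*0≈x c 0#) f (shift (suc e) f)

  factor-cong : ∀ x {f g} → f ≋ g → factor x f ≋ factor x g
  factor-cong (c , e) f≋g n = +-cong (f≋g n) (-‿cong (*-congˡ (shift-cong (suc e) f≋g n)))

  factors-cong : ∀ xs {f g} → f ≋ g → factors xs f ≋ factors xs g
  factors-cong []       f≋g = f≋g
  factors-cong (x ∷ xs) f≋g = factor-cong x (factors-cong xs f≋g)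

  factor-comm : ∀ x y f → factor x (factor y f) ≋ factor y (factor x f)
  factor-comm (a , i) (b , j) f n = begin
    (f n - b * Sj f n) - a * Si (factor (b , j) f) n
      ≈⟨ +-congˡ (-‿cong (*-congˡ (shift-factor (suc i) b j f n))) ⟩
    (f n - b * Sj f n) - a * (Si f n - b * Si (Sj f) n)
      ≈⟨ solve 6 (λ a b x y z w → ((x ⊕ ⊝ (b ⊗ y)) ⊕ ⊝ (a ⊗ (z ⊕ ⊝ (b ⊗ w))))
                                 ⊜ ((x ⊕ ⊝ (a ⊗ z)) ⊕ ⊝ (b ⊗ (y ⊕ ⊝ (a ⊗ w)))))
               refl a b (f n) (Sj f n) (Si f n) (Si (Sj f) n) ⟩
    (f n - a * Si f n) - b * (Sj f n - a * Si (Sj f) n)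
      ≡⟨ ≡.cong (λ t → (f n - a * Si f n) - b * (Sj f n - a * t)) (shift-comm (suc i) (suc j) f n) ⟩
    (f n - a * Si f n) - b * (Sj f n - a * Sj (Si f) n)
      ≈⟨ +-congˡ (-‿cong (*-congˡ (shift-factor (suc j) a i f n))) ⟨
    (f n - a * Si f n) - b * Sj (factor (a , i) f) n ∎
    where
    Si Sj : Series → Series
    Si = shift (suc i)
    Sj = shift (suc j)

  factors-factor : ∀ xs y f → factors xs (factor y f) ≋ factor y (factors xs f)
  factors-factor []       y f n = refl
  factors-factor (x ∷ xs) y f n =
    trans (factor-cong x (factors-factor xs y f) n) (factor-comm x y (factors xs f) n)

  factors-comm : ∀ xs ys f → factors xs (factors ys f) ≋ factors ys (factors xs f)
  factors-comm xs []       f n = refl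
  factors-comm xs (y ∷ ys) f n =
    trans (factors-factor xs y (factors ys f) n) (factor-cong y (factors-comm xs ys f) n)

  factors-++ : ∀ xs ys f → factors (xs ++ ys) f ≋ factors xs (factors ys f)
  factors-++ xs ys f n = reflexive (≡.cong-app (foldr-++ factor f xs ys) n)

  module _ {A : Set} where

    factors-concatMap-++ : ∀ (F G : A → List Binomial) is f →
      factors (concatMap F is) (factors (concatMap G is) f) ≋ factors (concatMap (λ i → F i ++ G i) is) f
    factors-concatMap-++ F G []       f n = refl
    factors-concatMap-++ F G (i ∷ is) f n = begin
      factors (F i ++ F*) (factors (G i ++ G*) f) n
        ≈⟨ factors-++ (F i) F* _ n ⟩
      factors (F i) (factors F* (factors (G i ++ G*) f)) n
        ≈⟨ factors-cong (F i) (factors-cong F* (factors-++ (G i) G* f)) n ⟩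
      factors (F i) (factors F* (factors (G i) (factors G* f))) n
        ≈⟨ factors-cong (F i) (factors-comm F* (G i) _) n ⟩
      factors (F i) (factors (G i) (factors F* (factors G* f))) n
        ≈⟨ factors-cong (F i) (factors-cong (G i) (factors-concatMap-++ F G is f)) n ⟩
      factors (F i) (factors (G i) (factors FG* f)) n
        ≈⟨ factors-cong (F i) (factors-++ (G i) FG* f) n ⟨
      factors (F i) (factors (G i ++ FG*) f) n
        ≈⟨ factors-++ (F i) (G i ++ FG*) f n ⟨
      factors (F i ++ (G i ++ FG*)) f n
        ≡⟨ ≡.cong (λ xs → factors xs f n) (≡.sym (++-assoc (F i) (G i) FG*)) ⟩
      factors ((F i ++ G i) ++ FG*) f n ∎
      where
      F* = concatMap F is
      G* = concatMap G is
      FG* = concatMap (λ i → F i ++ G i) is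

    factors-concatMap-cong : ∀ {F G : A → List Binomial} → (∀ i f → factors (F i) f ≋ factors (G i) f) →
                             ∀ is f → factors (concatMap F is) f ≋ factors (concatMap G is) f
    factors-concatMap-cong F≋G []       f n = refl
    factors-concatMap-cong {F} {G} F≋G (i ∷ is) f n = begin
      factors (F i ++ concatMap F is) f n            ≈⟨ factors-++ (F i) _ f n ⟩
      factors (F i) (factors (concatMap F is) f) n   ≈⟨ factors-cong (F i) (factors-concatMap-cong F≋G is f) n ⟩
      factors (F i) (factors (concatMap G is) f) n   ≈⟨ F≋G i _ n ⟩
      factors (G i) (factors (concatMap G is) f) n   ≈⟨ factors-++ (G i) _ f n ⟨
      factors (G i ++ concatMap G is) f n            ∎

  factor-zero : ∀ e f → factor (0# , e) f ≋ f
  factor-zero e f n = trans (+-congˡ (trans (-‿cong (zeroˡ _)) -0#≈0#)) (+-identityʳ (f n))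

  ≋⇒≋[] : ∀ {f g N} → f ≋ g → f ≋[ N ] g
  ≋⇒≋[] f≋g {k} _ = f≋g k

  ≋[]-trans : ∀ {f g h N} → f ≋[ N ] g → g ≋[ N ] h → f ≋[ N ] h
  ≋[]-trans f≋g g≋h k≤N = trans (f≋g k≤N) (g≋h k≤N)

  ≋[]-extend : ∀ {f g N} → f ≋[ N ] g → f (suc N) ≈ g (suc N) → f ≋[ suc N ] g
  ≋[]-extend f≋g eq k≤1+N =
    [ (λ k<1+N → f≋g (ℕ.≤-pred k<1+N)) , (λ { ≡.refl → eq }) ] (ℕ.m≤n⇒m<n∨m≡n k≤1+N)

  shift-≋[] : ∀ j {f g N} → f ≋[ N ] g → shift j f ≋[ N ] shift j g
  shift-≋[] zero    f≋g             = f≋g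
  shift-≋[] (suc j) f≋g {zero}  _   = refl
  shift-≋[] (suc j) f≋g {suc k} k<N = shift-≋[] j f≋g (ℕ.<⇒≤ k<N)

  factor-cancel-at : ∀ c e {f g} k → shift (suc e) f k ≈ shift (suc e) g k →
                     factor (c , e) f k ≈ factor (c , e) g k → f k ≈ g k
  factor-cancel-at c e {f} {g} k Sf≈Sg factor≈ =
    +-cancelʳ (- (c * shift (suc e) g k)) (f k) (g k)
      (trans (+-congˡ (-‿cong (*-congˡ (sym Sf≈Sg)))) factor≈)

  -- Invertibility of 1 - c q^(1+e): the coefficient of degree k of f is determined by that of
  -- f · (1 - c q^(1+e)) and the coefficients of f of lower degree.
  factor-cancel : ∀ x N {f g} → factor x f ≋[ N ] factor x g → f ≋[ N ] g
  factor-cancel (c , e) zero    {f} {g} eq z≤n = factor-cancel-at c e {f} {g} 0 refl (eq z≤n)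
  factor-cancel (c , e) (suc N) {f} {g} eq =
    ≋[]-extend f≋g (factor-cancel-at c e (suc N) (shift-≋[] e f≋g ℕ.≤-refl) (eq ℕ.≤-refl))
    where
    f≋g : f ≋[ N ] g
    f≋g = factor-cancel (c , e) N (λ k≤N → eq (ℕ.m≤n⇒m≤1+n k≤N))

  factors-cancel : ∀ xs N {f g} → factors xs f ≋[ N ] factors xs g → f ≋[ N ] g
  factors-cancel []       N eq = eq
  factors-cancel (x ∷ xs) N eq = factors-cancel xs N (factor-cancel x N eq)

  factor-high : ∀ c {e N} f → N ≤ e → factor (c , e) f ≋[ N ] f
  factor-high c f N≤e {k} k≤N = trans
    (reflexive (≡.cong (λ t → f k - c * t) (shift-below f (s≤s (ℕ.≤-trans k≤N N≤e)))))
    (x-c*0≈x c (f k))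

  infixl 7 _⊛_
  _⊛_ : Series → Series → Series
  (f ⊛ g) n = sumBy (λ k → f k * g (n ∸ k)) (upTo (suc n))

  ⊛-cong : ∀ {f f′ g g′} → f ≋ f′ → g ≋ g′ → f ⊛ g ≋ f′ ⊛ g′
  ⊛-cong f≋f′ g≋g′ n = sumBy-cong (λ k → *-cong (f≋f′ k) (g≋g′ (n ∸ k))) (upTo (suc n))

  ⊛-identityˡ : ∀ g → one ⊛ g ≋ g
  ⊛-identityˡ g n = begin
    1# * g n + sumBy (λ k → one k * g (n ∸ k)) (applyUpTo suc n)
      ≡⟨ ≡.cong (λ s → 1# * g n + s)
           (≡.trans (≡.cong (sumBy _) (≡.sym (map-upTo suc n))) (sumBy-map _ suc (upTo n))) ⟩
    1# * g n + sumBy (λ k → 0# * g (n ∸ suc k)) (upTo n)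
      ≈⟨ +-cong (*-identityˡ (g n)) (trans (sumBy-* 0# _ (upTo n)) (zeroˡ _)) ⟩
    g n + 0#  ≈⟨ +-identityʳ (g n) ⟩
    g n       ∎

  shift₁-⊛ : ∀ f g → shift₁ f ⊛ g ≋ shift₁ (f ⊛ g)
  shift₁-⊛ f g zero    = trans (+-identityʳ _) (zeroˡ (g 0))
  shift₁-⊛ f g (suc n) = begin
    0# * g (suc n) + sumBy (λ k → shift₁ f k * g (suc n ∸ k)) (applyUpTo suc (suc n))
      ≈⟨ trans (+-congʳ (zeroˡ _)) (+-identityˡ _) ⟩
    sumBy (λ k → shift₁ f k * g (suc n ∸ k)) (applyUpTo suc (suc n))
      ≡⟨ ≡.trans (≡.cong (sumBy _) (≡.sym (map-upTo suc (suc n)))) (sumBy-map _ suc (upTo (suc n))) ⟩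
    (f ⊛ g) n ∎

  ⊛-shift₁ : ∀ f g → f ⊛ shift₁ g ≋ shift₁ (f ⊛ g)
  ⊛-shift₁ f g zero    = trans (+-identityʳ _) (zeroʳ (f 0))
  ⊛-shift₁ f g (suc n) = begin
    sumBy h (upTo (suc (suc n)))
      ≡⟨ ≡.cong (sumBy h) (≡.sym (upTo-∷ʳ (suc n))) ⟩
    sumBy h (upTo (suc n) ∷ʳ suc n)
      ≈⟨ sumBy-∷ʳ h (upTo (suc n)) (suc n) ⟩
    sumBy h (upTo (suc n)) + h (suc n)
      ≈⟨ +-cong (sumBy-cong-local (applyUpTo⁺₁ id (suc n) inner-term)) last-term ⟩
    (f ⊛ g) n + 0#
      ≈⟨ +-identityʳ _ ⟩
    (f ⊛ g) n ∎
    where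
    h : ℕ → Carrier
    h k = f k * shift₁ g (suc n ∸ k)
    inner-term : ∀ {k} → k < suc n → h k ≈ f k * g (n ∸ k)
    inner-term {k} k<1+n = reflexive (≡.cong (λ m → f k * shift₁ g m) (ℕ.+-∸-assoc 1 (ℕ.≤-pred k<1+n)))
    last-term : h (suc n) ≈ 0#
    last-term = trans (reflexive (≡.cong (λ m → f (suc n) * shift₁ g m) (ℕ.n∸n≡0 n))) (zeroʳ _)

  shift-⊛ : ∀ j f g → shift j f ⊛ g ≋ shift j (f ⊛ g)
  shift-⊛ zero    f g n = refl
  shift-⊛ (suc j) f g n = trans (shift₁-⊛ (shift j f) g n) (shift-cong 1 (shift-⊛ j f g) n)

  ⊛-shift : ∀ j f g → f ⊛ shift j g ≋ shift j (f ⊛ g)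
  ⊛-shift zero    f g n = refl
  ⊛-shift (suc j) f g n = trans (⊛-shift₁ f (shift j g) n) (shift-cong 1 (⊛-shift j f g) n)

  factor-⊛ : ∀ x f g → factor x f ⊛ g ≋ factor x (f ⊛ g)
  factor-⊛ (c , e) f g n = begin
    sumBy (λ k → (f k - c * S f k) * g (n ∸ k)) (upTo (suc n))
      ≈⟨ sumBy-cong (λ k → expand (f k) (S f k) (g (n ∸ k))) (upTo (suc n)) ⟩
    sumBy (λ k → f k * g (n ∸ k) - c * (S f k * g (n ∸ k))) (upTo (suc n))
      ≈⟨ sumBy-linear _ c _ (upTo (suc n)) ⟩
    (f ⊛ g) n - c * (S f ⊛ g) n
      ≈⟨ +-congˡ (-‿cong (*-congˡ (shift-⊛ (suc e) f g n))) ⟩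
    (f ⊛ g) n - c * S (f ⊛ g) n ∎
    where
    S : Series → Series
    S = shift (suc e)
    expand : ∀ x y z → (x - c * y) * z ≈ x * z - c * (y * z)
    expand x y z = trans ([y-z]x≈yx-zx z x (c * y)) (+-congˡ (-‿cong (*-assoc c y z)))

  ⊛-factor : ∀ x f g → f ⊛ factor x g ≋ factor x (f ⊛ g)
  ⊛-factor (c , e) f g n = begin
    sumBy (λ k → f k * (g (n ∸ k) - c * S g (n ∸ k))) (upTo (suc n))
      ≈⟨ sumBy-cong (λ k → expand (f k) (g (n ∸ k)) (S g (n ∸ k))) (upTo (suc n)) ⟩
    sumBy (λ k → f k * g (n ∸ k) - c * (f k * S g (n ∸ k))) (upTo (suc n))
      ≈⟨ sumBy-linear _ c _ (upTo (suc n)) ⟩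
    (f ⊛ g) n - c * (f ⊛ S g) n
      ≈⟨ +-congˡ (-‿cong (*-congˡ (⊛-shift (suc e) f g n))) ⟩
    (f ⊛ g) n - c * S (f ⊛ g) n ∎
    where
    S : Series → Series
    S = shift (suc e)
    expand : ∀ x y z → x * (y - c * z) ≈ x * y - c * (x * z)
    expand x y z = trans (x[y-z]≈xy-xz x y (c * z)) (+-congˡ (-‿cong (x∙yz≈y∙xz x c z)))

  factors-⊛ : ∀ xs f g → factors xs f ⊛ g ≋ factors xs (f ⊛ g)
  factors-⊛ []       f g n = refl
  factors-⊛ (x ∷ xs) f g n = trans (factor-⊛ x (factors xs f) g n) (factor-cong x (factors-⊛ xs f g) n)

  ⊛-factors : ∀ xs f g → f ⊛ factors xs g ≋ factors xs (f ⊛ g)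
  ⊛-factors []       f g n = refl
  ⊛-factors (x ∷ xs) f g n = trans (⊛-factor x f (factors xs g) n) (factor-cong x (⊛-factors xs f g) n)

  -- ∏_{j=1}^{m} (1 - c j · q^j)
  binomials : (ℕ → Carrier) → ℕ → List Binomial
  binomials c m = concatMap (λ e → (c (suc e) , e) ∷ []) (downFrom m)

  partitionSeries : (List ℕ → Carrier) → ℕ → Series
  partitionSeries w m n = sumBy w (boundedPartitions m n)

  sumBy-shiftedPartitions : ∀ w j k n →
    sumBy w (shiftedPartitions j k n) ≡ shift (suc k) (partitionSeries w j) n
  sumBy-shiftedPartitions w j k       zero    = ≡.refl
  sumBy-shiftedPartitions w j zero    (suc n) = ≡.refl
  sumBy-shiftedPartitions w j (suc k) (suc n) = sumBy-shiftedPartitions w j k n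

  partitionSeries-suc : ∀ w m n → partitionSeries w (suc m) n ≈
    partitionSeries w m n + shift (suc m) (partitionSeries (w ∘ (suc m ∷_)) (suc m)) n
  partitionSeries-suc w m n = trans (sumBy-++ w (boundedPartitions m n) _)
    (+-congˡ (reflexive (≡.trans (sumBy-map w (suc m ∷_) (shiftedPartitions (suc m) m n))
                                  (sumBy-shiftedPartitions _ (suc m) m n))))

  partitionSeries-zero : ∀ {w} → w [] ≈ 1# → partitionSeries w 0 ≋ one
  partitionSeries-zero w[]≈1 zero    = trans (+-identityʳ _) w[]≈1
  partitionSeries-zero w[]≈1 (suc n) = refl

  module _ {w : List ℕ → Carrier} {c : ℕ → Carrier} (w[]≈1 : w [] ≈ 1#) where

    partitionSeries-inverse : (∀ p π → w (p ∷ π) ≈ c p * w π) →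
                              ∀ m → factors (binomials c m) (partitionSeries w m) ≋ one
    partitionSeries-inverse w-cons zero    = partitionSeries-zero w[]≈1
    partitionSeries-inverse w-cons (suc m) n = begin
      factor b (factors (binomials c m) X) n  ≈⟨ factors-factor (binomials c m) b X n ⟨
      factors (binomials c m) (factor b X) n  ≈⟨ factors-cong (binomials c m) remove-largest n ⟩
      factors (binomials c m) (partitionSeries w m) n  ≈⟨ partitionSeries-inverse w-cons m n ⟩
      one n                                    ∎
      where
      b = (c (suc m) , m)
      X = partitionSeries w (suc m)
      S = shift (suc m)
      remove-largest : factor b X ≋ partitionSeries w m
      remove-largest k = begin
        X k - c (suc m) * S X k
          ≈⟨ +-congʳ (partitionSeries-suc w m k) ⟩
        partitionSeries w m k + S (partitionSeries (w ∘ (suc m ∷_)) (suc m)) k - c (suc m) * S X k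
          ≈⟨ +-congʳ (+-congˡ (trans
               (shift-cong (suc m) (λ r → trans (sumBy-cong (w-cons (suc m)) (boundedPartitions (suc m) r))
                                                  (sumBy-* (c (suc m)) w (boundedPartitions (suc m) r))) k)
               (shift-map (suc m) (c (suc m) *_) (zeroʳ _) X k))) ⟩
        partitionSeries w m k + c (suc m) * S X k - c (suc m) * S X k
          ≈⟨ trans (+-assoc _ _ _) (trans (+-congˡ (-‿inverseʳ _)) (+-identityʳ _)) ⟩
        partitionSeries w m k ∎

    partitionSeries-distinct : (∀ p π → All (_< p) π → w (p ∷ π) ≈ - c p * w π) →
                               (∀ p π → w (p ∷ p ∷ π) ≈ 0#) →
                               ∀ m → partitionSeries w m ≋ factors (binomials c m) one
    partitionSeries-distinct w-cons w-repeat zero    = partitionSeries-zero w[]≈1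
    partitionSeries-distinct w-cons w-repeat (suc m) n = begin
      partitionSeries w (suc m) n
        ≈⟨ partitionSeries-suc w m n ⟩
      partitionSeries w m n + S (partitionSeries (w ∘ (suc m ∷_)) (suc m)) n
        ≈⟨ +-congˡ (trans (shift-cong (suc m) with-largest n)
                          (shift-map (suc m) (- c (suc m) *_) (zeroʳ _) (partitionSeries w m) n)) ⟩
      partitionSeries w m n + - c (suc m) * S (partitionSeries w m) n
        ≈⟨ +-congˡ (-‿distribˡ-* _ _) ⟨
      factor (c (suc m) , m) (partitionSeries w m) n
        ≈⟨ factor-cong (c (suc m) , m) (partitionSeries-distinct w-cons w-repeat m) n ⟩
      factors (binomials c (suc m)) one n ∎
      where
      S = shift (suc m)
      -- A repeated largest part contributes nothing, so only partitions with parts ≤ m remain.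
      with-largest : partitionSeries (w ∘ (suc m ∷_)) (suc m) ≋ λ r → - c (suc m) * partitionSeries w m r
      with-largest r = begin
        sumBy (w ∘ (suc m ∷_)) (boundedPartitions m r ++ map (suc m ∷_) (shiftedPartitions (suc m) m r))
          ≈⟨ sumBy-++ _ (boundedPartitions m r) _ ⟩
        sumBy (w ∘ (suc m ∷_)) (boundedPartitions m r) + sumBy (w ∘ (suc m ∷_)) (map (suc m ∷_) shifted)
          ≈⟨ +-cong (sumBy-cong-local (All.map (λ {π} (_ , parts≤m) → w-cons (suc m) π (All.map s≤s parts≤m))
                                                 (boundedPartitions-sound m r)))
                    (trans (reflexive (sumBy-map _ (suc m ∷_) shifted)) (sumBy-zero (w-repeat (suc m)) shifted)) ⟩
        sumBy (λ π → - c (suc m) * w π) (boundedPartitions m r) + 0#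
          ≈⟨ trans (+-identityʳ _) (sumBy-* _ w (boundedPartitions m r)) ⟩
        - c (suc m) * partitionSeries w m r ∎
        where
        shifted = shiftedPartitions (suc m) m r

  div3 notDiv3 : ℕ → Carrier
  div3    j = if does (3 ∣? j) then 1# else 0#
  notDiv3 j = if does (3 ∣? j) then 0# else 1#

  -- ∏_{j=1}^{m} (1 - q^(3j)), with the exponent 3j written as 1 + (2 + 3(j - 1))
  cubes : ℕ → List Binomial
  cubes m = concatMap (λ e → (1# , 2 ℕ.+ 3 ℕ.* e) ∷ []) (downFrom m)

  factor-coefficient : ∀ {c d} e f → c ≈ d → factor (c , e) f ≋ factor (d , e) f
  factor-coefficient e f c≈d n = +-congˡ (-‿cong (*-congʳ c≈d))

  binomials-div3-split : ∀ m f →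
    factors (binomials div3 m) (factors (binomials notDiv3 m) f) ≋ factors (binomials (λ _ → 1#) m) f
  binomials-div3-split m f n = trans (factors-concatMap-++ _ _ (downFrom m) f n)
    (factors-concatMap-cong (λ e → split (does (3 ∣? suc e)) e) (downFrom m) f n)
    where
    split : ∀ b e g →
      factors (((if b then 1# else 0#) , e) ∷ ((if b then 0# else 1#) , e) ∷ []) g ≋ factor (1# , e) g
    split true  e g = factor-cong (1# , e) (factor-zero e g)
    split false e g = factor-zero e (factor (1# , e) g)

  binomials-div3 : ∀ n f → factors (binomials div3 (3 ℕ.* n)) f ≋ factors (cubes n) f
  binomials-div3 zero    f k = refl
  binomials-div3 (suc n) f k = begin
    factors (binomials div3 (3 ℕ.* suc n)) f k
      ≡⟨ ≡.cong (λ m → factors (binomials div3 m) f k) (ℕ.*-suc 3 n) ⟩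
    factor (div3 (3 ℕ.+ 3 ℕ.* n) , 2 ℕ.+ 3 ℕ.* n)
      (factor (div3 (2 ℕ.+ 3 ℕ.* n) , 1 ℕ.+ 3 ℕ.* n) (factor (div3 (1 ℕ.+ 3 ℕ.* n) , 3 ℕ.* n) F)) k
      ≈⟨ factor-coefficient (2 ℕ.+ 3 ℕ.* n) _ (reflexive (div3≡1 (∣m∣n⇒∣m+n ∣-refl (m∣m*n n)))) k ⟩
    factor (1# , 2 ℕ.+ 3 ℕ.* n)
      (factor (div3 (2 ℕ.+ 3 ℕ.* n) , 1 ℕ.+ 3 ℕ.* n) (factor (div3 (1 ℕ.+ 3 ℕ.* n) , 3 ℕ.* n) F)) k
      ≈⟨ factor-cong (1# , 2 ℕ.+ 3 ℕ.* n) (λ k → trans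
           (trivial (1 ℕ.+ 3 ℕ.* n) _ (∤-remainder n (s≤s z≤n) (s≤s (s≤s (s≤s z≤n)))) k)
           (trivial (3 ℕ.* n) F (∤-remainder n (s≤s z≤n) (s≤s (s≤s z≤n))) k)) k ⟩
    factor (1# , 2 ℕ.+ 3 ℕ.* n) F k
      ≈⟨ factor-cong (1# , 2 ℕ.+ 3 ℕ.* n) (binomials-div3 n f) k ⟩
    factors (cubes (suc n)) f k ∎
    where
    F = factors (binomials div3 (3 ℕ.* n)) f
    div3≡1 : ∀ {j} → 3 ∣ j → div3 j ≡ 1#
    div3≡1 {j} 3∣j = ≡.cong (if_then 1# else 0#) (dec-true (3 ∣? j) 3∣j)
    trivial : ∀ {j} e g → ¬ 3 ∣ j → factor (div3 j , e) g ≋ g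
    trivial {j} e g 3∤j k = trans
      (factor-coefficient e g (reflexive (≡.cong (if_then 1# else 0#) (dec-false (3 ∣? j) 3∤j))) k)
      (factor-zero e g k)

  cubes-truncate : ∀ {n} K f → n ≤ K → factors (cubes K) f ≋[ n ] factors (cubes n) f
  cubes-truncate zero    f z≤n _ = refl
  cubes-truncate (suc K) f n≤1+K =
    [ (λ n<1+K → ≋[]-trans (factor-high 1# _ (ℕ.≤-trans (ℕ.≤-pred n<1+K) K≤2+3K))
                            (cubes-truncate K f (ℕ.≤-pred n<1+K)))
    , (λ { ≡.refl _ → refl })
    ] (ℕ.m≤n⇒m<n∨m≡n n≤1+K)
    where
    K≤2+3K : K ≤ 2 ℕ.+ 3 ℕ.* K
    K≤2+3K = ℕ.≤-trans (ℕ.m≤m+n K _) (ℕ.m≤n+m _ 2)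

-- Eisenstein integers

module Eisenstein where

  private
    module Components where
      open import Data.Integer using (_+_; _*_; -_)

      *-comm-re : ∀ a b c d → a * c + - (b * d) ≡ c * a + - (d * b)
      *-comm-re = ℤ-Solver.solve-∀
      *-comm-im : ∀ a b c d → a * d + b * c + - (b * d) ≡ c * b + d * a + - (d * b)
      *-comm-im = ℤ-Solver.solve-∀
      *-assoc-re : ∀ a b c d e f →
        (a * c + - (b * d)) * e + - ((a * d + b * c + - (b * d)) * f) ≡
        a * (c * e + - (d * f)) + - (b * (c * f + d * e + - (d * f)))
      *-assoc-re = ℤ-Solver.solve-∀
      *-assoc-im : ∀ a b c d e f →
        (a * c + - (b * d)) * f + (a * d + b * c + - (b * d)) * e + - ((a * d + b * c + - (b * d)) * f) ≡
        a * (c * f + d * e + - (d * f)) + b * (c * e + - (d * f)) + - (b * (c * f + d * e + - (d * f)))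
      *-assoc-im = ℤ-Solver.solve-∀
      *-identityˡ-re : ∀ c d → 1ℤ * c + - (0ℤ * d) ≡ c
      *-identityˡ-re = ℤ-Solver.solve-∀
      *-identityˡ-im : ∀ c d → 1ℤ * d + 0ℤ * c + - (0ℤ * d) ≡ d
      *-identityˡ-im = ℤ-Solver.solve-∀
      distribˡ-re : ∀ a b c d e f → a * (c + e) + - (b * (d + f)) ≡ (a * c + - (b * d)) + (a * e + - (b * f))
      distribˡ-re = ℤ-Solver.solve-∀
      distribˡ-im : ∀ a b c d e f →
        a * (d + f) + b * (c + e) + - (b * (d + f)) ≡ (a * d + b * c + - (b * d)) + (a * f + b * e + - (b * f))
      distribˡ-im = ℤ-Solver.solve-∀
      *-im-real : ∀ a c d → - (a * d + 0ℤ * c + - (0ℤ * d)) ≡ a * - d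
      *-im-real = ℤ-Solver.solve-∀

  infix 6 _+_·ω
  record ℤ[ω] : Set where
    constructor _+_·ω
    field
      re im : ℤ

  open ℤ[ω] public

  infix  8 -_
  infixl 7 _*_
  infixl 6 _+_

  _+_ : ℤ[ω] → ℤ[ω] → ℤ[ω]
  (a + b ·ω) + (c + d ·ω) = (a ℤ.+ c) + (b ℤ.+ d) ·ω

  -_ : ℤ[ω] → ℤ[ω]
  - (a + b ·ω) = ℤ.- a + ℤ.- b ·ω

  -- ω² = -1 - ω
  _*_ : ℤ[ω] → ℤ[ω] → ℤ[ω]
  (a + b ·ω) * (c + d ·ω) = (a ℤ.* c ℤ.+ ℤ.- (b ℤ.* d)) + (a ℤ.* d ℤ.+ b ℤ.* c ℤ.+ ℤ.- (b ℤ.* d)) ·ω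

  0# 1# ω : ℤ[ω]
  0# = 0ℤ + 0ℤ ·ω
  1# = 1ℤ + 0ℤ ·ω
  ω  = 0ℤ + 1ℤ ·ω

  open Components

  componentwise : ∀ {a b c d} → a ≡ c → b ≡ d → a + b ·ω ≡ c + d ·ω
  componentwise = ≡.cong₂ _+_·ω

  *-comm : ∀ x y → x * y ≡ y * x
  *-comm (a + b ·ω) (c + d ·ω) = componentwise (*-comm-re a b c d) (*-comm-im a b c d)

  *-identityˡ : ∀ x → 1# * x ≡ x
  *-identityˡ (c + d ·ω) = componentwise (*-identityˡ-re c d) (*-identityˡ-im c d)

  distribˡ : ∀ x y z → x * (y + z) ≡ x * y + x * z
  distribˡ (a + b ·ω) (c + d ·ω) (e + f ·ω) = componentwise (distribˡ-re a b c d e f) (distribˡ-im a b c d e f)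

  isCommutativeRing : IsCommutativeRing _≡_ _+_ _*_ -_ 0# 1#
  isCommutativeRing = record
    { isRing = record
      { +-isAbelianGroup = record
        { isGroup = record
          { isMonoid = record
            { isSemigroup = record
              { isMagma = record { isEquivalence = ≡.isEquivalence ; ∙-cong = ≡.cong₂ _+_ }
              ; assoc = λ x y z → componentwise (ℤ.+-assoc (re x) (re y) (re z)) (ℤ.+-assoc (im x) (im y) (im z))
              }
            ; identity = (λ x → componentwise (ℤ.+-identityˡ (re x)) (ℤ.+-identityˡ (im x)))
                       , (λ x → componentwise (ℤ.+-identityʳ (re x)) (ℤ.+-identityʳ (im x)))
            }
          ; inverse = (λ x → componentwise (ℤ.+-inverseˡ (re x)) (ℤ.+-inverseˡ (im x)))
                    , (λ x → componentwise (ℤ.+-inverseʳ (re x)) (ℤ.+-inverseʳ (im x)))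
          ; ⁻¹-cong = ≡.cong -_
          }
        ; comm = λ x y → componentwise (ℤ.+-comm (re x) (re y)) (ℤ.+-comm (im x) (im y))
        }
      ; *-cong = ≡.cong₂ _*_
      ; *-assoc = λ { (a + b ·ω) (c + d ·ω) (e + f ·ω) →
                      componentwise (*-assoc-re a b c d e f) (*-assoc-im a b c d e f) }
      ; *-identity = *-identityˡ , λ x → ≡.trans (*-comm x 1#) (*-identityˡ x)
      ; distrib = distribˡ , λ x y z → ≡.trans (*-comm (y + z) x)
                    (≡.trans (distribˡ x y z) (≡.cong₂ _+_ (*-comm x y) (*-comm x z)))
      }
    ; *-comm = *-comm
    }

  commutativeRing : CommutativeRing 0ℓ 0ℓ
  commutativeRing = record { isCommutativeRing = isCommutativeRing }

  private
    almostCommutativeRing : ACR.AlmostCommutativeRing 0ℓ 0ℓ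
    almostCommutativeRing = ACR.fromCommutativeRing commutativeRing λ where
      ((ℤ.+ 0) + (ℤ.+ 0) ·ω) → just ≡.refl
      _                      → nothing

  -- (1 - S)(1 - ω²S)(1 - ωS) = 1 - S³ for the shift S, evaluated at coefficients
  -- x = f n, y = (S f) n, z = (S² f) n, t = (S³ f) n.
  cube-expansion : ∀ x y z t →
    (x + - (ω * y)) + - (ω * ω * (y + - (ω * z))) + - (1# * ((y + - (ω * z)) + - (ω * ω * (z + - (ω * t)))))
    ≡ x + - (1# * t)
  cube-expansion = Solver.solve-∀ almostCommutativeRing

  ν : ℤ[ω] → ℤ
  ν x = ℤ.- im x

  ν-+ : ∀ x y → ν (x + y) ≡ ν x ℤ.+ ν y
  ν-+ x y = ℤ.neg-distrib-+ (im x) (im y)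

  ν-* : ∀ x y → im x ≡ 0ℤ → ν (x * y) ≡ re x ℤ.* ν y
  ν-* (a + b ·ω) (c + d ·ω) ≡.refl = *-im-real a c d

-- The identity in ℤ[ω]

open Eisenstein using (ℤ[ω]; re; im; ω; cube-expansion; ν; ν-+; ν-*)
open CommutativeRing Eisenstein.commutativeRing using (_+_; _*_; -_; _-_; 0#; 1#; *-assoc; *-identityˡ; ring; semiring)
open PowerSeries Eisenstein.commutativeRing
open import Algebra.Properties.Ring ring using (-1*x≈-x)
open import Algebra.Definitions.RawSemiring (Semiring.rawSemiring semiring) using (_^_)

factor-cube : ∀ e f → factors ((1# , e) ∷ (ω * ω , e) ∷ (ω , e) ∷ []) f ≋ factor (1# , 2 ℕ.+ 3 ℕ.* e) f
factor-cube e f n = begin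
  g₂ n - 1# * S g₂ n
    ≡⟨ ≡.cong₂ (λ u v → g₁ n - ω * ω * u - 1# * v) Sg₁≡ Sg₂≡ ⟩
  x - ω * y - ω * ω * (y - ω * z) - 1# * ((y - ω * z) - ω * ω * (z - ω * t))
    ≡⟨ cube-expansion x y z t ⟩
  x - 1# * t
    ≡⟨ ≡.cong (λ u → x - 1# * u) 3[1+e]≡ ⟩
  factor (1# , 2 ℕ.+ 3 ℕ.* e) f n ∎
  where
  open ≡.≡-Reasoning
  S = shift (suc e)
  g₁ = factor (ω , e) f
  g₂ = factor (ω * ω , e) g₁
  x = f n
  y = S f n
  z = S (S f) n
  t = S (S (S f)) n
  Sg₁≡ : S g₁ n ≡ y - ω * z
  Sg₁≡ = shift-factor (suc e) ω e f n
  Sg₂≡ : S g₂ n ≡ (y - ω * z) - ω * ω * (z - ω * t)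
  Sg₂≡ = ≡.trans (shift-factor (suc e) (ω * ω) e g₁ n)
           (≡.cong₂ (λ u v → u - ω * ω * v) Sg₁≡
             (≡.trans (shift-cong (suc e) (shift-factor (suc e) ω e f) n) (shift-factor (suc e) ω e (S f) n)))
  3[1+e]≡ : shift (suc e) (shift (suc e) (shift (suc e) f)) n ≡ shift (suc (2 ℕ.+ 3 ℕ.* e)) f n
  3[1+e]≡ = ≡.trans (shift-cong (suc e) (shift-+ (suc e) (suc e) f) n)
              (≡.trans (shift-+ (suc e) (suc e ℕ.+ suc e) f n) (≡.cong (λ k → shift k f n) (arithmetic e)))
    where
    arithmetic : ∀ e → suc e ℕ.+ (suc e ℕ.+ suc e) ≡ suc (2 ℕ.+ 3 ℕ.* e)
    arithmetic = ℕ-Solver.solve-∀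

binomials-cube : ∀ m f →
  factors (binomials (λ _ → 1#) m) (factors (binomials (λ _ → ω * ω) m) (factors (binomials (λ _ → ω) m) f))
  ≋ factors (cubes m) f
binomials-cube m f n = begin
  factors (binomials (λ _ → 1#) m) (factors (binomials (λ _ → ω * ω) m) (factors (binomials (λ _ → ω) m) f)) n
    ≡⟨ factors-cong (binomials (λ _ → 1#) m) (factors-concatMap-++ _ _ (downFrom m) f) n ⟩
  factors (binomials (λ _ → 1#) m) (factors (concatMap (λ e → (ω * ω , e) ∷ (ω , e) ∷ []) (downFrom m)) f) n
    ≡⟨ factors-concatMap-++ _ _ (downFrom m) f n ⟩
  factors (concatMap (λ e → (1# , e) ∷ (ω * ω , e) ∷ (ω , e) ∷ []) (downFrom m)) f n
    ≡⟨ factors-concatMap-cong factor-cube (downFrom m) f n ⟩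
  factors (cubes m) f n ∎
  where open ≡.≡-Reasoning

-- Multiplied by ∏_{j ≤ 3n} (1 - q^j)(1 - ω²q^j), both sides agree with ∏_{i ≤ n} (1 - q^(3i))
-- up to degree n, and these factors can be cancelled.
cube-root-identity : ∀ n {T Q} →
  factors (binomials notDiv3 (3 ℕ.* n)) T ≋ one → factors (binomials (λ _ → ω * ω) (3 ℕ.* n)) Q ≋ one →
  factors (binomials (λ _ → ω) (3 ℕ.* n)) one ≋[ n ] T ⊛ Q
cube-root-identity n {T} {Q} AT≋1 BQ≋1 = factors-cancel B n (factors-cancel C n
  (≋[]-trans (≋⇒≋[] (binomials-cube K one))
    (≋[]-trans (cubes-truncate K one (ℕ.m≤m+n n _)) (≋⇒≋[] (λ k → ≡.sym (CB[T⊛Q]≋cubes k))))))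
  where
  K = 3 ℕ.* n
  A = binomials notDiv3 K
  B = binomials (λ _ → ω * ω) K
  C = binomials (λ _ → 1#) K
  E = binomials div3 K
  CB[T⊛Q]≋cubes : factors C (factors B (T ⊛ Q)) ≋ factors (cubes n) one
  CB[T⊛Q]≋cubes k = begin
    factors C (factors B (T ⊛ Q)) k              ≡⟨ binomials-div3-split K _ k ⟨
    factors E (factors A (factors B (T ⊛ Q))) k  ≡⟨ factors-cong E (factors-cong A (⊛-factors B T Q)) k ⟨
    factors E (factors A (T ⊛ factors B Q)) k    ≡⟨ factors-cong E (factors-⊛ A T (factors B Q)) k ⟨
    factors E (factors A T ⊛ factors B Q) k      ≡⟨ factors-cong E (⊛-cong AT≋1 BQ≋1) k ⟩
    factors E (one ⊛ one) k                      ≡⟨ factors-cong E (⊛-identityˡ one) k ⟩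
    factors E one k                              ≡⟨ binomials-div3 n one k ⟩
    factors (cubes n) one k                      ∎
    where open ≡.≡-Reasoning

-- ℤ[ω]-valued weights from which wP₁ = ν ∘ ωP₁, wP₂ = re ∘ ωP₂ and wP₃ = ν ∘ ωP₃ are read off.
ωP₁ ωP₂ ωP₃ : List ℕ → ℤ[ω]
ωP₁ π = if distinct π then (- ω) ^ length π else 0#
ωP₂ π = if noPartDiv3 π then 1# else 0#
ωP₃ π = (ω * ω) ^ length π

ωP₁-cons : ∀ p π → All (_< p) π → ωP₁ (p ∷ π) ≡ - ω * ωP₁ π
ωP₁-cons p π parts<p
  rewrite dec-true (all? (λ y → ¬? (p ℕ.≟ y)) π) (All.map (λ y<p p≡y → ℕ.<-irrefl (≡.sym p≡y) y<p) parts<p)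
  with distinct π
... | true  = ≡.refl
... | false = ≡.refl

ωP₁-repeat : ∀ p π → ωP₁ (p ∷ p ∷ π) ≡ 0#
ωP₁-repeat p π
  rewrite dec-false (all? (λ y → ¬? (p ℕ.≟ y)) (p ∷ π)) (λ { (p≢p ∷ _) → p≢p ≡.refl }) = ≡.refl

ωP₂-cons : ∀ p π → ωP₂ (p ∷ π) ≡ notDiv3 p * ωP₂ π
ωP₂-cons p π = by-cases (does (3 ∣? p)) (noPartDiv3 π)
  where
  by-cases : ∀ b c → (if not b ∧ c then 1# else 0#) ≡ (if b then 0# else 1#) * (if c then 1# else 0#)
  by-cases true  c     = ≡.refl
  by-cases false true  = ≡.refl
  by-cases false false = ≡.refl

ωP₃-cons : ∀ p π → ωP₃ (p ∷ π) ≡ ω * ω * ωP₃ π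
ωP₃-cons _ _ = ≡.refl

sgn-3+ : ∀ k → sgn (3 ℕ.+ k) ≡ ℤ.- sgn k
sgn-3+ k = minus-cube (sgn k)
  where
  minus-cube : ∀ s → -1ℤ ℤ.* (-1ℤ ℤ.* (-1ℤ ℤ.* s)) ≡ ℤ.- s
  minus-cube = ℤ-Solver.solve-∀

pow-3+ : ∀ c k → c ^ (3 ℕ.+ k) ≡ (c * (c * c)) * c ^ k
pow-3+ c k = ≡.trans (≡.cong (c *_) (≡.sym (*-assoc c c (c ^ k)))) (≡.sym (*-assoc c (c * c) (c ^ k)))

-ω-period : ∀ k → (- ω) ^ (3 ℕ.+ k) ≡ - ((- ω) ^ k)
-ω-period k = ≡.trans (pow-3+ (- ω) k) (-1*x≈-x ((- ω) ^ k))

ω²-period : ∀ k → (ω * ω) ^ (3 ℕ.+ k) ≡ (ω * ω) ^ k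
ω²-period k = ≡.trans (pow-3+ (ω * ω) k) (*-identityˡ ((ω * ω) ^ k))

wP₁-signs : ∀ π → (if countNot0mod3 π then sgn (μ π) else 0ℤ) ≡ ν ((- ω) ^ length π)
wP₁-signs []              = ≡.refl
wP₁-signs (_ ∷ [])        = ≡.refl
wP₁-signs (_ ∷ _ ∷ [])    = ≡.refl
wP₁-signs (_ ∷ _ ∷ _ ∷ π)
  with does (¬? ((length π ℕ.% 3) ℕ.≟ 0)) | does ((length π ℕ.% 3) ℕ.≟ 2) | wP₁-signs π
... | true  | σ₂ | ih = ≡.trans (sgn-3+ (length π ℕ.+ (if σ₂ then 1 else 0) ℕ.+ 1))
                          (≡.trans (≡.cong ℤ.-_ ih) (≡.cong ν (≡.sym (-ω-period (length π)))))
... | false | _  | ih = ≡.trans (≡.cong ℤ.-_ ih) (≡.cong ν (≡.sym (-ω-period (length π))))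

wP₁≡ν∘ωP₁ : ∀ π → wP₁ π ≡ ν (ωP₁ π)
wP₁≡ν∘ωP₁ π with distinct π
... | true  = wP₁-signs π
... | false = ≡.refl

wP₂≡re∘ωP₂ : ∀ π → wP₂ π ≡ re (ωP₂ π)
wP₂≡re∘ωP₂ π with noPartDiv3 π
... | true  = ≡.refl
... | false = ≡.refl

wP₃≡ν∘ωP₃ : ∀ π → wP₃ π ≡ ν (ωP₃ π)
wP₃≡ν∘ωP₃ []              = ≡.refl
wP₃≡ν∘ωP₃ (_ ∷ [])        = ≡.refl
wP₃≡ν∘ωP₃ (_ ∷ _ ∷ [])    = ≡.refl
wP₃≡ν∘ωP₃ (_ ∷ _ ∷ _ ∷ π) = ≡.trans (wP₃≡ν∘ωP₃ π) (≡.cong ν (≡.sym (ω²-period (length π))))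

im-sumBy-ωP₂ : ∀ xs → im (sumBy ωP₂ xs) ≡ 0ℤ
im-sumBy-ωP₂ []       = ≡.refl
im-sumBy-ωP₂ (π ∷ xs) = ≡.cong₂ ℤ._+_ (im-ωP₂ π) (im-sumBy-ωP₂ xs)
  where
  im-ωP₂ : ∀ π → im (ωP₂ π) ≡ 0ℤ
  im-ωP₂ π with noPartDiv3 π
  ... | true  = ≡.refl
  ... | false = ≡.refl

sumℤ-map : ∀ (φ : ℤ[ω] → ℤ) → (∀ x y → φ (x + y) ≡ φ x ℤ.+ φ y) → φ 0# ≡ 0ℤ →
           ∀ {A : Set} (h : A → ℤ[ω]) xs → sumℤ (map (φ ∘ h) xs) ≡ φ (sumBy h xs)
sumℤ-map φ φ-+ φ-0 h []       = ≡.sym φ-0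
sumℤ-map φ φ-+ φ-0 h (x ∷ xs) =
  ≡.trans (≡.cong (λ s → φ (h x) ℤ.+ s) (sumℤ-map φ φ-+ φ-0 h xs)) (≡.sym (φ-+ (h x) (sumBy h xs)))

module _ {L : ℕ → List (List ℕ)} (L-enumerates : ∀ n π → π ∈ L n ⇔ IsPartitionOf n π)
         (L-unique : ∀ n → Unique (L n)) where

  sumℤ-enumeration : ∀ (φ : ℤ[ω] → ℤ) → (∀ x y → φ (x + y) ≡ φ x ℤ.+ φ y) → φ 0# ≡ 0ℤ →
                     ∀ {v w} → (∀ π → v π ≡ φ (w π)) → ∀ {K k} → k ≤ K →
                     sumℤ (map v (L k)) ≡ φ (partitionSeries w K k)
  sumℤ-enumeration φ φ-+ φ-0 {v} {w} v≡φ∘w {K} {k} k≤K = begin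
    sumℤ (map v (L k))          ≡⟨ ≡.cong sumℤ (map-cong v≡φ∘w (L k)) ⟩
    sumℤ (map (φ ∘ w) (L k))    ≡⟨ sumℤ-map φ φ-+ φ-0 w (L k) ⟩
    φ (sumBy w (L k))           ≡⟨ ≡.cong φ (sumBy-↭ w (↭-boundedPartitions (L-unique k) (L-enumerates k) k≤K)) ⟩
    φ (partitionSeries w K k)   ∎
    where open ≡.≡-Reasoning

partitionSeries-identity : ∀ n → let K = 3 ℕ.* n in
  partitionSeries ωP₁ K ≋[ n ] partitionSeries ωP₂ K ⊛ partitionSeries ωP₃ K
partitionSeries-identity n = ≋[]-trans
  (≋⇒≋[] (partitionSeries-distinct {ωP₁} {λ _ → ω} ≡.refl ωP₁-cons ωP₁-repeat (3 ℕ.* n)))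
  (cube-root-identity n (partitionSeries-inverse {ωP₂} {notDiv3} ≡.refl ωP₂-cons (3 ℕ.* n))
                        (partitionSeries-inverse {ωP₃} {λ _ → ω * ω} ≡.refl ωP₃-cons (3 ℕ.* n)))

theorem32 : (L : ℕ → List (List ℕ))
    → (∀ n π → (π ∈ L n) ⇔ IsPartitionOf n π)
    → (∀ n → Unique (L n))
    → ∀ n → lhsCoeff L n ≡ rhsCoeff L n
theorem32 L L-enumerates L-unique n = begin
  lhsCoeff L n
    ≡⟨ count-ν wP₁≡ν∘ωP₁ n≤K ⟩
  ν (partitionSeries ωP₁ K n)
    ≡⟨ ≡.cong ν (partitionSeries-identity n ℕ.≤-refl) ⟩
  ν ((T ⊛ Q) n)
    ≡⟨ sumℤ-map ν ν-+ ≡.refl (λ k → T k * Q (n ∸ k)) (upTo (suc n)) ⟨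
  sumℤ (map (λ k → ν (T k * Q (n ∸ k))) (upTo (suc n)))
    ≡⟨ ≡.cong sumℤ (map-cong-local (applyUpTo⁺₁ id (suc n) term≡)) ⟩
  rhsCoeff L n ∎
  where
  open ≡.≡-Reasoning
  K = 3 ℕ.* n
  T = partitionSeries ωP₂ K
  Q = partitionSeries ωP₃ K
  n≤K : n ≤ K
  n≤K = ℕ.m≤m+n n _
  count-ν = sumℤ-enumeration L-enumerates L-unique ν ν-+ ≡.refl
  count-re = sumℤ-enumeration L-enumerates L-unique re (λ _ _ → ≡.refl) ≡.refl
  term≡ : ∀ {k} → k < suc n → ν (T k * Q (n ∸ k)) ≡ sumℤ (map wP₂ (L k)) ℤ.* sumℤ (map wP₃ (L (n ∸ k)))
  term≡ {k} k<1+n = ≡.trans (ν-* (T k) (Q (n ∸ k)) (im-sumBy-ωP₂ (boundedPartitions K k)))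
    (≡.cong₂ ℤ._*_ (≡.sym (count-re wP₂≡re∘ωP₂ (ℕ.≤-trans (ℕ.≤-pred k<1+n) n≤K)))
                   (≡.sym (count-ν wP₃≡ν∘ωP₃ (ℕ.≤-trans (ℕ.m∸n≤m n k) n≤K))))
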